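{- For all integers $t \geq 4$ and $k \geq 1$, $$gr_{k}(K_{3}:P_{t}^{+})\geq\begin{cases}2(t-1)\cdot5^{\frac{k-2}{2}}+1 & \text{ if $k$ is even,}\\ (t-1)\cdot5^{\frac{k-1}{2}}+1 & \text{ if $k$ is odd.}\end{cases}$$
   Context: For $t \geq 3$, $P_t$ denotes the path on $t$ vertices $v_1v_2\cdots v_t$, and $P_t^{+}$ denotes the graph obtained from $P_t$ by adding the edge $v_1v_3$ (forming a triangle at one end). A coloring of the edges of a graph is rainbow if no two edges receive the same color. For a positive integer $k$ and a graph $H$, the Gallai-Ramsey number $gr_k(K_3:H)$ is the minimum integer $m$ such that every coloring of the edges of the complete graph $K_m$ using at most $k$ colors contains either a rainbow triangle or a monochromatic copy of $H$. -}

module Defs where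

open import Data.Nat using (ℕ; _+_; _*_; _^_; _∸_; _≤_; _/_)
open import Data.Nat using (_%_)
open import Data.Fin using (Fin; zero; suc; inject₁)
open import Data.Sum using (_⊎_)
open import Data.Product using (Σ; _×_; ∃; ∃-syntax)
open import Relation.Binary.PropositionalEquality using (_≡_; _≢_)
open import Relation.Nullary using (¬_)
open import Function.Definitions using (Injective)

-- An edge-colouring of the complete graph K_m with (at most) k colours.
-- c x y is the colour of the edge {x,y}; only values at x ≢ y matter,
-- and we require symmetry so that c really colours undirected edges.
record Colouring (m k : ℕ) : Set where
  field
    col  : Fin m → Fin m → Fin k
    symm : ∀ x y → col x y ≡ col y x
open Colouring public

RainbowTriangle : ∀ {m k} → Colouring m k → Set
RainbowTriangle {m} c =
  ∃[ x ] ∃[ y ] ∃[ z ]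
    (x ≢ y × y ≢ z × x ≢ z ×
     col c x y ≢ col c y z × col c y z ≢ col c x z × col c x y ≢ col c x z)

-- A monochromatic copy of P_t^+ for t = 3 + s (so t ≥ 3): an injective
-- vertex map v : Fin t → Fin m (v_1 … v_t are v 0 … v (t-1)) and a colour j
-- such that every path edge v_i v_{i+1} and the extra edge v_1 v_3 get colour j.
MonoPtPlus : ∀ {m k} (s : ℕ) → Colouring m k → Set
MonoPtPlus {m} {k} s c =
  Σ (Fin (3 + s) → Fin m) λ v → Σ (Fin k) λ j →
    Injective _≡_ _≡_ v ×
    (∀ (i : Fin (2 + s)) → col c (v (inject₁ i)) (v (suc i)) ≡ j) ×
    col c (v zero) (v (suc (suc zero))) ≡ j

GRProperty : (k s m : ℕ) → Set
GRProperty k s m = (c : Colouring m k) → RainbowTriangle c ⊎ MonoPtPlus s c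

-- gr_k(K_3 : P_t^+) ≥ N, i.e. N is at most the minimum m with the
-- gr-property: every m with the property satisfies N ≤ m.
grLowerBound : (k s N : ℕ) → Set
grLowerBound k s N = ∀ m → GRProperty k s m → N ≤ m

bound : (t k : ℕ) → ℕ
bound t k with k % 2
... | 0 = 2 * (t ∸ 1) * 5 ^ ((k ∸ 2) / 2) + 1
... | _ = (t ∸ 1) * 5 ^ ((k ∸ 1) / 2) + 1

module Submission where

-- Lower bound gr_k(K_3 : P_t^+) > m is witnessed by a "good" colouring:
-- a k-colouring of K_m with neither a rainbow triangle nor a monochromatic
-- P_t^+ (any smaller complete graph inherits such a colouring by restriction).
-- Good colourings are built by the classical substitution construction:
-- replace every vertex of a pattern colouring H (r new colours, no rainbow
-- and no monochromatic triangle) by a copy of a good colouring G, colouring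
-- edges inside a copy by G and edges between copies by H.  A rainbow
-- triangle of the result would give one in G or H, and a monochromatic
-- P_t^+ in a new colour would contain a monochromatic triangle of H, while
-- in an old colour it is connected and hence lies inside a single copy.
-- Starting from K_{t-1} with one colour (k odd) or from two such copies
-- joined in a second colour (k even), and substituting into the pentagon
-- C_5 (two colours) (k-1)/2 resp. (k-2)/2 times, gives the bound.

open import Defs
open import Data.Nat using (ℕ; _+_; _≤_)
open import Relation.Binary.PropositionalEquality using (_≡_)

open import Data.Nat using (suc; _*_; _^_; _∸_; _<_; _%_; _/_; _≤?_; s≤s; z≤n)
open import Data.Nat.Properties using (≰⇒>; n<1+n; +-suc; +-comm; +-identityʳ; *-comm; *-assoc; *-identityˡ)
open import Data.Nat.DivMod using ([m+kn]%n≡m%n; m*n/n≡m)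
open import Data.Fin using (Fin; zero; suc; inject₁; inject≤; quotient; remainder; combine; join; splitAt; _≟_)
open import Data.Fin.Properties using (inject≤-injective; combine-remQuot; splitAt-join; pigeonhole; all?; <⇒≢)
open import Data.Product using (Σ; _×_; _,_; proj₁; proj₂)
open import Data.Sum using (_⊎_; inj₁; inj₂; [_,_]′)
open import Data.Empty using (⊥; ⊥-elim)
open import Data.Unit using (tt)
open import Function using (_∘_)
open import Relation.Nullary using (¬_; Dec; yes; no)
open import Relation.Nullary.Decidable using (toWitness; _×-dec_; ¬?)
open import Relation.Binary.PropositionalEquality using (_≢_; refl; sym; trans; cong; cong₂; subst; subst₂)

record GoodColouring (s m k : ℕ) : Set where
  field
    colouring  : Colouring m k
    noRainbow  : ¬ RainbowTriangle colouring
    noMonoPath : ¬ MonoPtPlus s colouring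
open GoodColouring

pullback : ∀ {s m n k} (f : Fin m → Fin n) → (∀ {x y} → f x ≡ f y → x ≡ y) →
           GoodColouring s n k → GoodColouring s m k
pullback {s} {m} {n} {k} f f-inj G = record
  { colouring = c ; noRainbow = noRainbow′ ; noMonoPath = noMonoPath′ }
  where
  c : Colouring m k
  c = record { col = λ x y → col (colouring G) (f x) (f y) ; symm = λ x y → symm (colouring G) (f x) (f y) }
  noRainbow′ : ¬ RainbowTriangle c
  noRainbow′ (x , y , z , x≢y , y≢z , x≢z , rainbow) =
    noRainbow G (f x , f y , f z , x≢y ∘ f-inj , y≢z ∘ f-inj , x≢z ∘ f-inj , rainbow)
  noMonoPath′ : ¬ MonoPtPlus s c
  noMonoPath′ (v , j , v-inj , mono) = noMonoPath G (f ∘ v , j , v-inj ∘ f-inj , mono)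

-- A good colouring of K_m shows gr_k(K_3 : P_t^+) ≥ m + 1: a colouring of
-- any K_n with n ≤ m is obtained by restriction and is again good.
good⇒lowerBound : ∀ {s m k} → GoodColouring s m k → grLowerBound k s (suc m)
good⇒lowerBound {s} {m} {k} G n property with n ≤? m
... | no n≰m  = ≰⇒> n≰m
... | yes n≤m = ⊥-elim ([ noRainbow restricted , noMonoPath restricted ]′ (property (colouring restricted)))
  where
  restricted : GoodColouring s n k
  restricted = pullback (λ x → inject≤ x n≤m) (inject≤-injective n≤m n≤m _ _) G

noThreeDistinct : ∀ {n} → n < 3 → (a b d : Fin n) → a ≢ b → b ≢ d → a ≢ d → ⊥
noThreeDistinct {n} n<3 a b d a≢b b≢d a≢d with pigeonhole n<3 triple
  where
  triple : Fin 3 → Fin n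
  triple zero             = a
  triple (suc zero)       = b
  triple (suc (suc zero)) = d
... | zero             , suc zero       , _ , a≡b = a≢b a≡b
... | zero             , suc (suc zero) , _ , a≡d = a≢d a≡d
... | suc zero         , suc (suc zero) , _ , b≡d = b≢d b≡d
... | zero             , zero           , () , _
... | suc zero         , zero           , () , _
... | suc zero         , suc zero       , s≤s () , _
... | suc (suc zero)   , zero           , () , _
... | suc (suc zero)   , suc zero       , s≤s () , _
... | suc (suc zero)   , suc (suc zero) , s≤s (s≤s ()) , _

fewColours⇒noRainbow : ∀ {m k} → k < 3 → (c : Colouring m k) → ¬ RainbowTriangle c
fewColours⇒noRainbow k<3 c (x , y , z , _ , _ , _ , xy≢yz , yz≢xz , xy≢xz) =
  noThreeDistinct k<3 (col c x y) (col c y z) (col c x z) xy≢yz yz≢xz xy≢xz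

fewVertices⇒noMonoPath : ∀ {s m k} → m < 3 + s → (c : Colouring m k) → ¬ MonoPtPlus s c
fewVertices⇒noMonoPath m<3+s c (v , _ , v-inj , _) with pigeonhole m<3+s v
... | i , j , i<j , vi≡vj = <⇒≢ i<j (v-inj vi≡vj)

monochromaticClique : ∀ s → GoodColouring s (2 + s) 1
monochromaticClique s = record
  { colouring  = c
  ; noRainbow  = fewColours⇒noRainbow (s≤s (s≤s z≤n)) c
  ; noMonoPath = fewVertices⇒noMonoPath (n<1+n (2 + s)) c }
  where
  c : Colouring (2 + s) 1
  c = record { col = λ _ _ → zero ; symm = λ _ _ → refl }

MonoTriangleAt : ∀ {p r} → Colouring p r → Fin p → Fin p → Fin p → Set
MonoTriangleAt c a b d =
  a ≢ b × b ≢ d × a ≢ d × col c a b ≡ col c b d × col c a b ≡ col c a d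

record Pattern (p r : ℕ) : Set where
  field
    patternColouring  : Colouring p r
    patternNoRainbow  : ¬ RainbowTriangle patternColouring
    patternNoTriangle : ∀ a b d → ¬ MonoTriangleAt patternColouring a b d
open Pattern

singleEdge : Pattern 2 1
singleEdge = record
  { patternColouring  = c
  ; patternNoRainbow  = fewColours⇒noRainbow (s≤s (s≤s z≤n)) c
  ; patternNoTriangle = λ { a b d (a≢b , b≢d , a≢d , _) → noThreeDistinct (n<1+n 2) a b d a≢b b≢d a≢d } }
  where
  c : Colouring 2 1
  c = record { col = λ _ _ → zero ; symm = λ _ _ → refl }

-- The pentagon C_5 in colour 0 and its complement (again a C_5) in colour 1.
pentagonColour : Fin 5 → Fin 5 → Fin 2
pentagonColour zero                                (suc zero)                          = zero
pentagonColour (suc zero)                          (suc (suc zero))                    = zero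
pentagonColour (suc (suc zero))                    (suc (suc (suc zero)))              = zero
pentagonColour (suc (suc (suc zero)))              (suc (suc (suc (suc zero))))        = zero
pentagonColour (suc (suc (suc (suc zero))))        zero                                = zero
pentagonColour (suc zero)                          zero                                = zero
pentagonColour (suc (suc zero))                    (suc zero)                          = zero
pentagonColour (suc (suc (suc zero)))              (suc (suc zero))                    = zero
pentagonColour (suc (suc (suc (suc zero))))        (suc (suc (suc zero)))              = zero
pentagonColour zero                                (suc (suc (suc (suc zero))))        = zero
pentagonColour _                                   _                                   = suc zero

pentagon : Pattern 5 2
pentagon = record
  { patternColouring  = c
  ; patternNoRainbow  = fewColours⇒noRainbow (n<1+n 2) c
  ; patternNoTriangle = toWitness {a? = all? λ a → all? λ b → all? λ d → ¬? (monoTriangle? a b d)} tt }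
  where
  c : Colouring 5 2
  c = record
    { col  = pentagonColour
    ; symm = toWitness {a? = all? λ a → all? λ b → pentagonColour a b ≟ pentagonColour b a} tt }
  monoTriangle? : ∀ a b d → Dec (MonoTriangleAt c a b d)
  monoTriangle? a b d =
    ¬? (a ≟ b) ×-dec ¬? (b ≟ d) ×-dec ¬? (a ≟ d) ×-dec
    (pentagonColour a b ≟ pentagonColour b d) ×-dec (pentagonColour a b ≟ pentagonColour a d)

-- A walk along consecutive equal values is constant: used to see that a path
-- in an old colour never leaves its block.
constantAlongPath : ∀ {n} {A : Set} (f : Fin (suc n) → A) →
                    (∀ i → f (inject₁ i) ≡ f (suc i)) → ∀ a → f a ≡ f zero
constantAlongPath f step zero = refl
constantAlongPath {suc n} f step (suc a) =
  trans (constantAlongPath (f ∘ suc) (step ∘ suc) a) (sym (step zero))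

-- Substituting a good colouring G into every vertex of a pattern P.  Vertex
-- x of the new graph lies in copy `block x` of G at vertex `position x`; the
-- r new colours (those of P) come first, the k old colours (those of G) after.
module Substitution {s m k p r} (G : GoodColouring s m k) (P : Pattern p r) where

  c : Colouring m k
  c = colouring G

  H : Colouring p r
  H = patternColouring P

  block : Fin (p * m) → Fin p
  block = quotient m

  position : Fin (p * m) → Fin m
  position = remainder {p} m

  block-position-injective : ∀ {x y} → block x ≡ block y → position x ≡ position y → x ≡ y
  block-position-injective {x} {y} same-block same-position =
    trans (sym (combine-remQuot {p} m x))
          (trans (cong₂ combine same-block same-position) (combine-remQuot {p} m y))

  edgeColour : Fin (p * m) → Fin (p * m) → Fin r ⊎ Fin k
  edgeColour x y with block x ≟ block y
  ... | yes _ = inj₂ (col c (position x) (position y))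
  ... | no _  = inj₁ (col H (block x) (block y))

  inside : ∀ {x y} → block x ≡ block y → edgeColour x y ≡ inj₂ (col c (position x) (position y))
  inside {x} {y} same with block x ≟ block y
  ... | yes _    = refl
  ... | no other = ⊥-elim (other same)

  between : ∀ {x y} → block x ≢ block y → edgeColour x y ≡ inj₁ (col H (block x) (block y))
  between {x} {y} other with block x ≟ block y
  ... | yes same = ⊥-elim (other same)
  ... | no _     = refl

  edgeColour-symm : ∀ x y → edgeColour x y ≡ edgeColour y x
  edgeColour-symm x y with block x ≟ block y
  ... | yes same = trans (cong inj₂ (symm c (position x) (position y))) (sym (inside (sym same)))
  ... | no other = trans (cong inj₁ (symm H (block x) (block y))) (sym (between (other ∘ sym)))

  inside⁻¹ : ∀ {x y i} → edgeColour x y ≡ inj₂ i →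
             block x ≡ block y × col c (position x) (position y) ≡ i
  inside⁻¹ {x} {y} e with block x ≟ block y | e
  ... | yes same | refl = same , refl
  ... | no _     | ()

  between⁻¹ : ∀ {x y j} → edgeColour x y ≡ inj₁ j →
              block x ≢ block y × col H (block x) (block y) ≡ j
  between⁻¹ {x} {y} e with block x ≟ block y | e
  ... | yes _    | ()
  ... | no other | refl = other , refl

  sharedBlock : ∀ {a b z} → block a ≡ block b → block a ≢ block z → edgeColour a z ≡ edgeColour b z
  sharedBlock {a} {b} {z} same other =
    trans (between other)
          (trans (cong (λ u → inj₁ (col H u (block z))) same) (sym (between (other ∘ trans same))))

  insideAgree : ∀ {a b a′ b′} → block a ≡ block b → block a′ ≡ block b′ →
                col c (position a) (position b) ≡ col c (position a′) (position b′) →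
                edgeColour a b ≡ edgeColour a′ b′
  insideAgree same same′ e = trans (inside same) (trans (cong inj₂ e) (sym (inside same′)))

  betweenAgree : ∀ {a b a′ b′} → block a ≢ block b → block a′ ≢ block b′ →
                 col H (block a) (block b) ≡ col H (block a′) (block b′) →
                 edgeColour a b ≡ edgeColour a′ b′
  betweenAgree other other′ e = trans (between other) (trans (cong inj₁ e) (sym (between other′)))

  substituted : Colouring (p * m) (r + k)
  substituted = record
    { col  = λ x y → join r k (edgeColour x y)
    ; symm = λ x y → cong (join r k) (edgeColour-symm x y) }

  colour⇒edgeColour : ∀ {x y j} → col substituted x y ≡ j → edgeColour x y ≡ splitAt r j
  colour⇒edgeColour {x} {y} e = trans (sym (splitAt-join r k (edgeColour x y))) (cong (splitAt r) e)

  -- A rainbow triangle meets one block (rainbow in G), three blocks (rainbow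
  -- in P), or two blocks, where two of its edges get the same colour of P.
  substitutedNoRainbow : ¬ RainbowTriangle substituted
  substitutedNoRainbow (x , y , z , x≢y , y≢z , x≢z , xy≢yz , yz≢xz , xy≢xz) =
    byBlocks (block x ≟ block y) (block y ≟ block z) (block x ≟ block z)
    where
    xy≢yz′ : edgeColour x y ≢ edgeColour y z
    xy≢yz′ = xy≢yz ∘ cong (join r k)
    yz≢xz′ : edgeColour y z ≢ edgeColour x z
    yz≢xz′ = yz≢xz ∘ cong (join r k)
    xy≢xz′ : edgeColour x y ≢ edgeColour x z
    xy≢xz′ = xy≢xz ∘ cong (join r k)

    byBlocks : Dec (block x ≡ block y) → Dec (block y ≡ block z) → Dec (block x ≡ block z) → ⊥
    byBlocks (yes xy) (yes yz) (yes xz) = noRainbow G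
      ( position x , position y , position z
      , x≢y ∘ block-position-injective xy , y≢z ∘ block-position-injective yz
      , x≢z ∘ block-position-injective xz
      , xy≢yz′ ∘ insideAgree xy yz , yz≢xz′ ∘ insideAgree yz xz , xy≢xz′ ∘ insideAgree xy xz )
    byBlocks (yes xy) (yes yz) (no xz)  = xz (trans xy yz)
    byBlocks (yes xy) (no yz)  (yes xz) = yz (trans (sym xy) xz)
    byBlocks (no xy)  (yes yz) (yes xz) = xy (trans xz (sym yz))
    byBlocks (yes xy) (no _)   (no xz)  = yz≢xz′ (sym (sharedBlock xy xz))
    byBlocks (no xy)  (yes yz) (no _)   =
      xy≢xz′ (trans (edgeColour-symm x y) (trans (sharedBlock yz (xy ∘ sym)) (edgeColour-symm z x)))
    byBlocks (no xy)  (no _)   (yes xz) =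
      xy≢yz′ (trans (sharedBlock xz xy) (edgeColour-symm z y))
    byBlocks (no xy)  (no yz)  (no xz)  = patternNoRainbow P
      ( block x , block y , block z , xy , yz , xz
      , xy≢yz′ ∘ betweenAgree xy yz , yz≢xz′ ∘ betweenAgree yz xz , xy≢xz′ ∘ betweenAgree xy xz )

  -- A monochromatic P_t^+ in a new colour has its triangle v₀v₁v₂ spread over
  -- three blocks, giving a monochromatic triangle of P; in an old colour it
  -- stays inside one block, giving a monochromatic P_t^+ in G.
  substitutedNoMonoPath : ¬ MonoPtPlus s substituted
  substitutedNoMonoPath (v , j , v-inj , path , extra) =
    monochromaticIn (splitAt r j) (colour⇒edgeColour ∘ path) (colour⇒edgeColour extra)
    where
    monochromaticIn : (σ : Fin r ⊎ Fin k) → (∀ i → edgeColour (v (inject₁ i)) (v (suc i)) ≡ σ) →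
                      edgeColour (v zero) (v (suc (suc zero))) ≡ σ → ⊥
    monochromaticIn (inj₁ _) path′ extra′
      with between⁻¹ (path′ zero) | between⁻¹ (path′ (suc zero)) | between⁻¹ extra′
    ... | b₀₁ , h₀₁ | b₁₂ , h₁₂ | b₀₂ , h₀₂ =
      patternNoTriangle P _ _ _ (b₀₁ , b₁₂ , b₀₂ , trans h₀₁ (sym h₁₂) , trans h₀₁ (sym h₀₂))
    monochromaticIn (inj₂ i) path′ extra′ =
      noMonoPath G (position ∘ v , i , position-injective , proj₂ ∘ inside⁻¹ ∘ path′ , proj₂ (inside⁻¹ extra′))
      where
      sameBlock : ∀ a → block (v a) ≡ block (v zero)
      sameBlock = constantAlongPath (block ∘ v) (proj₁ ∘ inside⁻¹ ∘ path′)
      position-injective : ∀ {a b} → position (v a) ≡ position (v b) → a ≡ b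
      position-injective {a} {b} e = v-inj (block-position-injective (trans (sameBlock a) (sym (sameBlock b))) e)

  substitution : GoodColouring s (p * m) (r + k)
  substitution = record
    { colouring = substituted ; noRainbow = substitutedNoRainbow ; noMonoPath = substitutedNoMonoPath }

substitute : ∀ {s m k p r} → GoodColouring s m k → Pattern p r → GoodColouring s (p * m) (r + k)
substitute = Substitution.substitution

iterate : ∀ {s m k} j → GoodColouring s m k → GoodColouring s (5 ^ j * m) (k + j * 2)
iterate {s} {m} {k} 0 G = subst₂ (GoodColouring s) (sym (*-identityˡ m)) (sym (+-identityʳ k)) G
iterate {s} {m} {k} (suc j) G =
  subst₂ (GoodColouring s) (sym (*-assoc 5 (5 ^ j) m)) colours (substitute (iterate j G) pentagon)
  where
  colours : 2 + (k + j * 2) ≡ k + (2 + j * 2)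
  colours = sym (trans (+-suc k (suc (j * 2))) (cong suc (+-suc k (j * 2))))

oddConstruction : ∀ s j → GoodColouring s (5 ^ j * (2 + s)) (1 + j * 2)
oddConstruction s j = iterate j (monochromaticClique s)

evenConstruction : ∀ s j → GoodColouring s (5 ^ j * (2 * (2 + s))) (2 + j * 2)
evenConstruction s j = iterate j (substitute (monochromaticClique s) singleEdge)

half : ∀ j → j * 2 / 2 ≡ j
half j = m*n/n≡m j 2

odd-mod : ∀ j → (1 + j * 2) % 2 ≡ 1
odd-mod j = [m+kn]%n≡m%n 1 j 2

even-mod : ∀ j → (2 + j * 2) % 2 ≡ 0
even-mod j = [m+kn]%n≡m%n 2 j 2

bound-odd : ∀ t j → bound t (1 + j * 2) ≡ suc (5 ^ j * (t ∸ 1))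
bound-odd t j rewrite odd-mod j | half j =
  trans (+-comm ((t ∸ 1) * 5 ^ j) 1) (cong suc (*-comm (t ∸ 1) (5 ^ j)))

bound-even : ∀ t j → bound t (2 + j * 2) ≡ suc (5 ^ j * (2 * (t ∸ 1)))
bound-even t j rewrite even-mod j | half j =
  trans (+-comm (2 * (t ∸ 1) * 5 ^ j) 1) (cong suc (*-comm (2 * (t ∸ 1)) (5 ^ j)))

parity : ∀ k → (Σ ℕ λ j → k ≡ j * 2) ⊎ (Σ ℕ λ j → k ≡ 1 + j * 2)
parity 0 = inj₁ (0 , refl)
parity (suc k) with parity k
... | inj₁ (j , k≡2j)   = inj₂ (j , cong suc k≡2j)
... | inj₂ (j , k≡2j+1) = inj₁ (suc j , cong suc k≡2j+1)

-- Theorem: for t = 3 + s and k ≥ 1, gr_k(K_3 : P_t^+) ≥ bound t k; the good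
-- colourings above exist for every t ≥ 3.
lemma11 : (t k : ℕ) → 4 ≤ t → 1 ≤ k →
    ∀ s → t ≡ 3 + s → grLowerBound k s (bound t k)
lemma11 t k _ 1≤k s refl with parity k
... | inj₂ (j , refl) =
  subst (grLowerBound k s) (sym (bound-odd t j)) (good⇒lowerBound (oddConstruction s j))
... | inj₁ (suc j , refl) =
  subst (grLowerBound k s) (sym (bound-even t j)) (good⇒lowerBound (evenConstruction s j))
... | inj₁ (0 , refl) with 1≤k
... | ()
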